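{- Let $G=(V,E)$ be an undirected graph with positive edge weights, let $s\in V$ and $\phi\ge0$. For any vertex $t\in\mathrm{ct}(s,\phi)$ and any minimum $s$-$t$ cut, the side of that cut containing $t$ is entirely contained in $\mathrm{ct}(s,\phi)$.
   Context: For $Z\subseteq V$, $\delta(Z)$ is the total weight of edges with exactly one endpoint in $Z$. For distinct $s,t\in V$, $\lambda(s,t)$ is the minimum of $\delta(Z)$ over $Z\subseteq V$ containing exactly one of $s,t$; a minimum $s$-$t$ cut is a bipartition $(V\setminus Z, Z)$ with $t\in Z$, $s\notin Z$ and $\delta(Z)=\lambda(s,t)$. The cut threshold is $\mathrm{ct}(s,\phi) := \{t\in V\setminus\{s\} : \lambda(s,t)\le\phi\}$.
   Formalization: The edge weights and the threshold φ are rational. -}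

module Defs where

open import Data.Nat using (ℕ; zero; suc)
open import Data.Bool using (Bool; true; false; if_then_else_; _xor_)
open import Data.Fin using (Fin; zero; suc)
open import Data.Fin.Subset using (Subset; inside; outside; _∈_; _∉_; ⁅_⁆)
open import Data.Vec using (Vec; []; _∷_; lookup)
open import Data.List using (List; []; _∷_; _++_; map; filterᵇ; foldr)
open import Data.Rational using (ℚ; 0ℚ; _+_; _⊓_; _≤_)
open import Data.Product using (_×_)
open import Relation.Binary.PropositionalEquality using (_≡_; _≢_)

-- A weighted undirected graph is given by a weight
-- function w : Fin n → Fin n → ℚ (symmetric, nonnegative); the edges are the
-- pairs {u,v} with w u v > 0, and w u v = 0 means "no edge".

sumFin : ∀ {n} → (Fin n → ℚ) → ℚ
sumFin {zero}  f = 0ℚ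
sumFin {suc n} f = f zero + sumFin {n} (λ i → f (suc i))

-- δ(Z): total weight of edges with exactly one endpoint in Z.
-- Each such edge {u,v} is counted once, as the ordered pair with u ∈ Z, v ∉ Z.
δ : ∀ {n} → (Fin n → Fin n → ℚ) → Subset n → ℚ
δ w Z = sumFin (λ u → sumFin (λ v →
          if lookup Z u then (if lookup Z v then 0ℚ else w u v) else 0ℚ))

allSubsets : (n : ℕ) → List (Subset n)
allSubsets zero    = [] ∷ []
allSubsets (suc n) = map (inside ∷_) (allSubsets n) ++ map (outside ∷_) (allSubsets n)

separatesᵇ : ∀ {n} → Fin n → Fin n → Subset n → Bool
separatesᵇ s t Z = lookup Z s xor lookup Z t

-- The fold starts from δ(⁅ t ⁆), which is itself one of the candidates
-- whenever s ≢ t (the only case in which λ(s,t) is used), so this is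
-- exactly the minimum.
λc : ∀ {n} → (Fin n → Fin n → ℚ) → Fin n → Fin n → ℚ
λc {n} w s t = foldr _⊓_ (δ w ⁅ t ⁆) (map (δ w) (filterᵇ (separatesᵇ s t) (allSubsets n)))

_∈ct[_,_,_] : ∀ {n} → Fin n → (Fin n → Fin n → ℚ) → Fin n → ℚ → Set
t ∈ct[ w , s , φ ] = (t ≢ s) × (λc w s t ≤ φ)

IsMinCut : ∀ {n} → (Fin n → Fin n → ℚ) → Fin n → Fin n → Subset n → Set
IsMinCut w s t Z = (t ∈ Z) × (s ∉ Z) × (δ w Z ≡ λc w s t)

{-# OPTIONS --safe #-}
module Submission where

-- Every subset Z with s ∉ Z and v ∈ Z is a candidate in the minimum defining
-- λ(s,v), so λ(s,v) ≤ δ(Z).  If Z is the t-side of a minimum s-t cut, then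
-- δ(Z) = λ(s,t) ≤ φ, hence every v ∈ Z lies in ct(s,φ).

open import Defs
open import Data.Nat using (suc)
open import Data.Bool using (true; false; T)
open import Data.Unit using (tt)
open import Data.Fin using (Fin)
open import Data.Fin.Subset using (Subset; _∈_; _∉_; inside; outside)
open import Data.Vec using ([]; _∷_; lookup)
open import Data.Vec.Properties using ([]=⇒lookup; lookup⇒[]=)
open import Data.List using (List; _∷_; map; foldr; filterᵇ)
import Data.List.Membership.Propositional as List
open import Data.List.Membership.Propositional.Properties
  using (∈-filter⁺; ∈-map⁺; ∈-++⁺ˡ; ∈-++⁺ʳ)
open import Data.List.Relation.Unary.Any using (here; there)
open import Data.Rational using (ℚ; 0ℚ; _≤_; _⊓_)
open import Data.Rational.Properties using (≤-trans; ≤-reflexive; p⊓q≤p; p⊓q≤q)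
open import Data.Product using (_,_)
open import Data.Empty using (⊥-elim)
open import Relation.Nullary.Decidable.Core using (T?)
open import Relation.Binary.PropositionalEquality using (_≡_; _≢_; refl)

∈-allSubsets : ∀ {n} (Z : Subset n) → Z List.∈ allSubsets n
∈-allSubsets []                    = here refl
∈-allSubsets {suc n} (inside ∷ Z)  = ∈-++⁺ˡ (∈-map⁺ (inside ∷_) (∈-allSubsets Z))
∈-allSubsets {suc n} (outside ∷ Z) =
  ∈-++⁺ʳ (map (inside ∷_) (allSubsets n)) (∈-map⁺ (outside ∷_) (∈-allSubsets Z))

foldr-⊓-≤-∈ : ∀ (b : ℚ) (xs : List ℚ) {x} → x List.∈ xs → foldr _⊓_ b xs ≤ x
foldr-⊓-≤-∈ b (y ∷ xs) (here refl) = p⊓q≤p y _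
foldr-⊓-≤-∈ b (y ∷ xs) (there x∈xs) = ≤-trans (p⊓q≤q y _) (foldr-⊓-≤-∈ b xs x∈xs)

separates-∉-∈ : ∀ {n} {s v : Fin n} {Z : Subset n} → s ∉ Z → v ∈ Z → T (separatesᵇ s v Z)
separates-∉-∈ {s = s} {v} {Z} s∉Z v∈Z with lookup Z s in eq
... | true  = ⊥-elim (s∉Z (lookup⇒[]= s Z eq))
... | false rewrite []=⇒lookup v∈Z = tt

λc-≤-δ : ∀ {n} (w : Fin n → Fin n → ℚ) {s v : Fin n} {Z : Subset n} →
         s ∉ Z → v ∈ Z → λc w s v ≤ δ w Z
λc-≤-δ {n} w {s} {v} {Z} s∉Z v∈Z = foldr-⊓-≤-∈ _ _ (∈-map⁺ (δ w) Z∈candidates)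
  where
    Z∈candidates : Z List.∈ filterᵇ (separatesᵇ s v) (allSubsets n)
    Z∈candidates = ∈-filter⁺ (λ Y → T? (separatesᵇ s v Y)) (∈-allSubsets Z) (separates-∉-∈ s∉Z v∈Z)

∈∧∉⇒≢ : ∀ {n} {s v : Fin n} {Z : Subset n} → s ∉ Z → v ∈ Z → v ≢ s
∈∧∉⇒≢ s∉Z v∈Z refl = s∉Z v∈Z

lemma2p4 : ∀ {n : _} (w : Fin n → Fin n → ℚ)
             → (∀ u v → w u v ≡ w v u)
             → (∀ u v → 0ℚ ≤ w u v)
             → (s : Fin n) (φ : ℚ) → 0ℚ ≤ φ
             → (t : Fin n) → t ∈ct[ w , s , φ ]
             → (Z : Subset n) → IsMinCut w s t Z
             → ∀ v → v ∈ Z → v ∈ct[ w , s , φ ]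
lemma2p4 w _ _ s φ _ t (_ , λst≤φ) Z (_ , s∉Z , δZ≡λst) v v∈Z =
  ∈∧∉⇒≢ s∉Z v∈Z ,
  ≤-trans (λc-≤-δ w s∉Z v∈Z) (≤-trans (≤-reflexive δZ≡λst) λst≤φ)
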